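{- Let $\alpha$ and $\beta$ be two distinct multilinear monomials of equal degree in $N$ variables with $\Delta(\alpha,\beta)=\Delta$. Let $S_\alpha$ (resp. $S_\beta$) be the set of all monomials $\alpha\gamma$ (resp. $\beta\gamma$) where $\gamma$ ranges over monomials in the $N$ variables of degree $\ell$ whose support has size exactly $m$. Then $|S_\alpha\cap S_\beta|\le\binom{N-\Delta}{m-\Delta}\binom{\ell-1}{m-1}$.
   Context: The support of a monomial is the set of variables with positive exponent in it. For monomials $m_1,m_2$ with multisets of variables $S_1,S_2$, the distance is $\Delta(m_1,m_2)=\min\{|S_1|-|S_1\cap S_2|,\ |S_2|-|S_1\cap S_2|\}$ (cardinalities of multisets). -}

module Defs where

open import Data.Nat using (ℕ; zero; suc; _+_; _*_; _∸_; _⊓_; _≤_; _<?_)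
open import Data.Nat.Combinatorics using (_C_)
open import Data.Vec using (Vec; zipWith; sum; toList)
open import Data.Vec.Relation.Unary.All using (All)
open import Data.List using (List; length; filter)
open import Data.Product using (Σ; _×_)
open import Relation.Binary.PropositionalEquality using (_≡_)
open import Relation.Nullary using (¬_)
open import Relation.Nullary.Decidable using (does)
open import Data.Bool using (if_then_else_)
import Data.Nat as ℕ

Monomial : ℕ → Set
Monomial N = Vec ℕ N

deg : ∀ {N} → Monomial N → ℕ
deg = sum

_·_ : ∀ {N} → Monomial N → Monomial N → Monomial N
_·_ = zipWith _+_

Multilinear : ∀ {N} → Monomial N → Set
Multilinear = All (_≤ 1)

suppSize : ∀ {N} → Monomial N → ℕ
suppSize μ = length (filter (λ e → 0 ℕ.<? e) (toList μ))

-- cardinality of the multiset intersection of the variable multisets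
commonSize : ∀ {N} → Monomial N → Monomial N → ℕ
commonSize a b = sum (zipWith _⊓_ a b)

dist : ∀ {N} → Monomial N → Monomial N → ℕ
dist a b = (deg a ∸ commonSize a b) ⊓ (deg b ∸ commonSize a b)

InS : ∀ {N} → (ℓ m : ℕ) → Monomial N → Monomial N → Set
InS {N} ℓ m α μ = Σ (Monomial N) λ γ → (deg γ ≡ ℓ) × (suppSize γ ≡ m) × (μ ≡ α · γ)

binomDiff : ℕ → ℕ → ℕ → ℕ
binomDiff n a b = if does (a <? b) then 0 else n C (a ∸ b)

-- Sending μ = α γ to its cofactor γ is injective, and if also
-- μ = β γ′ then γ is positive at each of the Δ variables that occur in β but
-- not in α (for multilinear α, β of equal degree there are exactly Δ of them,
-- and Δ ≥ 1 as α ≠ β). It remains to count the γ of degree ℓ with support of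
-- size m containing a fixed set of Δ variables: the rest of the support is
-- chosen in binom(N − Δ, m − Δ) ways, and the exponents on the support form a
-- composition of ℓ into m positive parts, of which there are binom(ℓ − 1, m − 1).
-- Both factors are obtained by recursion on the first exponent, which
-- reproduces their Pascal recurrences.
module Submission where

open import Defs
open import Data.Bool using (Bool; true; false; not; T)
open import Data.Empty using (⊥-elim)
open import Data.List using (List; []; _∷_; length; map; filter)
open import Data.List.Properties using (length-map)
open import Data.List.Relation.Unary.All using (All; []; _∷_)
import Data.List.Relation.Unary.All as All
import Data.List.Relation.Unary.All.Properties as All
open import Data.List.Relation.Unary.AllPairs using ([]; _∷_)
open import Data.List.Relation.Unary.Unique.Propositional using (Unique)
import Data.List.Relation.Unary.Unique.Propositional.Properties as Unique
open import Data.Nat using (ℕ; zero; suc; pred; _+_; _*_; _∸_; _⊓_; _≤_; _<_; z≤n; s≤s; _≟_)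
open import Data.Nat.Properties
open import Data.Nat.Combinatorics using (_C_; nCk+nC[k+1]≡[n+1]C[k+1])
open import Data.Product using (_×_; _,_)
open import Data.Vec using (Vec; []; _∷_; head; tail; replicate; zipWith; sum; countᵇ)
open import Data.Vec.Relation.Binary.Pointwise.Inductive using (Pointwise; []; _∷_)
open import Data.Vec.Relation.Unary.All using ([]; _∷_)
open import Function using (_∘_; id; case_of_)
open import Level using (0ℓ)
open import Relation.Binary.PropositionalEquality
open import Relation.Nullary using (¬_; does)
open import Relation.Unary using (Pred; Decidable; _∩_; ∁)
open import Relation.Unary.Properties using (∁?)

module _ {A : Set} where

  HasAtMost : ℕ → Pred A 0ℓ → Set
  HasAtMost k P = (xs : List A) → Unique xs → All P xs → length xs ≤ k

  HasAtMost-mono : ∀ {P a b} → a ≤ b → HasAtMost a P → HasAtMost b P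
  HasAtMost-mono a≤b bound xs u ps = ≤-trans (bound xs u ps) a≤b

  HasAtMost-∅ : ∀ {P k} → (∀ {x} → ¬ P x) → HasAtMost k P
  HasAtMost-∅ ¬P []       _ _        = z≤n
  HasAtMost-∅ ¬P (_ ∷ _)  _ (p ∷ _) = ⊥-elim (¬P p)

  HasAtMost-subsingleton : ∀ {P k} → (∀ {x y} → P x → P y → x ≡ y) → (∀ {x} → P x → 1 ≤ k) →
                           HasAtMost k P
  HasAtMost-subsingleton same pos []          _                 _           = z≤n
  HasAtMost-subsingleton same pos (_ ∷ [])    _                 (p ∷ _)     = pos p
  HasAtMost-subsingleton same pos (_ ∷ _ ∷ _) ((x≢y ∷ _) ∷ _) (p ∷ q ∷ _) = ⊥-elim (x≢y (same p q))

  length-filter+length-filter-∁ : ∀ {Q : Pred A 0ℓ} (Q? : Decidable Q) xs →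
    length (filter Q? xs) + length (filter (∁? Q?) xs) ≡ length xs
  length-filter+length-filter-∁ Q? [] = refl
  length-filter+length-filter-∁ Q? (x ∷ xs) with ih ← length-filter+length-filter-∁ Q? xs | does (Q? x)
  ... | true  = cong suc ih
  ... | false = trans (+-suc _ _) (cong suc ih)

  HasAtMost-partition : ∀ {P Q : Pred A 0ℓ} {a b} (Q? : Decidable Q) →
    HasAtMost a (P ∩ Q) → HasAtMost b (P ∩ ∁ Q) → HasAtMost (a + b) P
  HasAtMost-partition {P = P} Q? boundQ bound∁Q xs u ps = begin
    length xs                                              ≡⟨ length-filter+length-filter-∁ Q? xs ⟨
    length (filter Q? xs) + length (filter (∁? Q?) xs)   ≤⟨ +-mono-≤ (part Q? boundQ) (part (∁? Q?) bound∁Q) ⟩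
    _                                                      ∎
    where
    open ≤-Reasoning
    part : ∀ {R : Pred A 0ℓ} {k} (R? : Decidable R) → HasAtMost k (P ∩ R) → length (filter R? xs) ≤ k
    part R? bound = bound _ (Unique.filter⁺ R? u)
                      (All.zipWith id (All.filter⁺ R? ps , All.all-filter R? xs))

module _ {A B : Set} {P : Pred A 0ℓ} (f : A → B) (injective : ∀ {x y} → P x → P y → f x ≡ f y → x ≡ y) where

  Unique-map⁺-on : ∀ {xs} → All P xs → Unique xs → Unique (map f xs)
  Unique-map⁺-on []         []          = []
  Unique-map⁺-on (px ∷ pxs) (x∉ ∷ u) =
    All.map⁺ (All.zipWith (λ (py , x≢y) → x≢y ∘ injective px py) (pxs , x∉)) ∷ Unique-map⁺-on pxs u

  HasAtMost-injection : ∀ {Q : Pred B 0ℓ} {k} → (∀ {x} → P x → Q (f x)) → HasAtMost k Q → HasAtMost k P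
  HasAtMost-injection into bound xs u ps =
    subst (_≤ _) (length-map f xs) (bound (map f xs) (Unique-map⁺-on ps u) (All.gmap⁺ into ps))

trues falses : ∀ {n} → Vec Bool n → ℕ
trues  = countᵇ id
falses = countᵇ not

falses+trues : ∀ {n} (bs : Vec Bool n) → falses bs + trues bs ≡ n
falses+trues []           = refl
falses+trues (true ∷ bs)  = trans (+-suc (falses bs) (trues bs)) (cong suc (falses+trues bs))
falses+trues (false ∷ bs) = cong suc (falses+trues bs)

Covers : ∀ {n} → Vec Bool n → Vec ℕ n → Set
Covers = Pointwise (λ b e → T b → 0 < e)

Covering : ∀ {n} → Vec Bool n → ℕ → ℕ → Pred (Vec ℕ n) 0ℓ
Covering bs ℓ m γ = sum γ ≡ ℓ × suppSize γ ≡ m × Covers bs γ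

compositions : ℕ → ℕ → ℕ
compositions zero    zero    = 1
compositions zero    (suc m) = 0
compositions (suc ℓ) zero    = 0
compositions (suc ℓ) (suc m) = compositions ℓ m + compositions ℓ (suc m)

compositions-suc : ∀ ℓ m → compositions (suc ℓ) (suc m) ≡ ℓ C m
compositions-suc zero    zero    = refl
compositions-suc zero    (suc m) = refl
compositions-suc (suc ℓ) zero    = compositions-suc ℓ zero
compositions-suc (suc ℓ) (suc m) =
  trans (cong₂ _+_ (compositions-suc ℓ m) (compositions-suc ℓ (suc m))) (nCk+nC[k+1]≡[n+1]C[k+1] ℓ m)

compositions≤binomDiff : ∀ ℓ m → compositions ℓ (suc m) ≤ binomDiff (ℓ ∸ 1) (suc m) 1
compositions≤binomDiff zero    m = z≤n
compositions≤binomDiff (suc ℓ) m = ≤-reflexive (compositions-suc ℓ m)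

binomDiff-pascal : ∀ K m D → binomDiff (suc K) (suc m) D ≡ binomDiff K (suc m) D + binomDiff K m D
binomDiff-pascal K m       zero          = trans (sym (nCk+nC[k+1]≡[n+1]C[k+1] K m)) (+-comm (K C m) (K C suc m))
binomDiff-pascal K zero    (suc zero)    = refl
binomDiff-pascal K zero    (suc (suc D)) = refl
binomDiff-pascal K (suc m) (suc D)       = binomDiff-pascal K m D

suppSize≤sum : ∀ {n} (γ : Vec ℕ n) → suppSize γ ≤ sum γ
suppSize≤sum []          = z≤n
suppSize≤sum (zero ∷ γ)  = suppSize≤sum γ
suppSize≤sum (suc e ∷ γ) = s≤s (≤-trans (suppSize≤sum γ) (m≤n+m (sum γ) e))

suppSize≡0⇒sum≡0 : ∀ {n} (γ : Vec ℕ n) → suppSize γ ≡ 0 → sum γ ≡ 0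
suppSize≡0⇒sum≡0 []         _ = refl
suppSize≡0⇒sum≡0 (zero ∷ γ) p = suppSize≡0⇒sum≡0 γ p

sum≡0⇒≡replicate : ∀ {n} (γ : Vec ℕ n) → sum γ ≡ 0 → γ ≡ replicate n 0
sum≡0⇒≡replicate []         _ = refl
sum≡0⇒≡replicate (zero ∷ γ) s = cong (0 ∷_) (sum≡0⇒≡replicate γ s)

Covers⇒trues≤suppSize : ∀ {n} {bs : Vec Bool n} {γ} → Covers bs γ → trues bs ≤ suppSize γ
Covers⇒trues≤suppSize {bs = []}                     []      = z≤n
Covers⇒trues≤suppSize {bs = true ∷ _}  {zero ∷ _}   (c ∷ _) with () ← c _
Covers⇒trues≤suppSize {bs = true ∷ _}  {suc _ ∷ _}  (_ ∷ c) = s≤s (Covers⇒trues≤suppSize c)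
Covers⇒trues≤suppSize {bs = false ∷ _} {zero ∷ _}   (_ ∷ c) = Covers⇒trues≤suppSize c
Covers⇒trues≤suppSize {bs = false ∷ _} {suc _ ∷ _}  (_ ∷ c) = m≤n⇒m≤1+n (Covers⇒trues≤suppSize c)

HeadZero : ∀ {n} → Pred (Vec ℕ (suc n)) 0ℓ
HeadZero γ = head γ ≡ 0

HeadOne : ∀ {n} → Pred (Vec ℕ (suc n)) 0ℓ
HeadOne γ = head γ ≡ 1

decrementHead : ∀ {n} → Vec ℕ (suc n) → Vec ℕ (suc n)
decrementHead (e ∷ γ) = pred e ∷ γ

tail-injective-on-head : ∀ {n} {γ δ : Vec ℕ (suc n)} → head γ ≡ head δ → tail γ ≡ tail δ → γ ≡ δ
tail-injective-on-head {γ = _ ∷ _} {_ ∷ _} refl refl = refl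

decrementHead-injective-on-¬HeadZero : ∀ {n} {γ δ : Vec ℕ (suc n)} → ¬ HeadZero γ → ¬ HeadZero δ →
                                       decrementHead γ ≡ decrementHead δ → γ ≡ δ
decrementHead-injective-on-¬HeadZero {γ = zero ∷ _}  γ≢0 _ _    = ⊥-elim (γ≢0 refl)
decrementHead-injective-on-¬HeadZero {δ = zero ∷ _}  _ δ≢0 _    = ⊥-elim (δ≢0 refl)
decrementHead-injective-on-¬HeadZero {γ = suc _ ∷ _} {suc _ ∷ _} _ _ refl = refl

covering-zero : ∀ {n} (bs : Vec Bool n) m →
                HasAtMost (binomDiff (falses bs) m (trues bs) * compositions 0 m) (Covering bs 0 m)
covering-zero bs m = HasAtMost-subsingleton same nonempty
  where
  same : ∀ {γ δ} → Covering bs 0 m γ → Covering bs 0 m δ → γ ≡ δ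
  same {γ} {δ} (γ≡0 , _) (δ≡0 , _) = trans (sum≡0⇒≡replicate γ γ≡0) (sym (sum≡0⇒≡replicate δ δ≡0))
  nonempty : ∀ {γ} → Covering bs 0 m γ → 1 ≤ binomDiff (falses bs) m (trues bs) * compositions 0 m
  nonempty {γ} (s , p , c) =
    subst₂ (λ m′ D → 1 ≤ binomDiff (falses bs) m′ D * compositions 0 m′) (sym m≡0) (sym trues≡0) ≤-refl
    where
    suppSize≤0 : suppSize γ ≤ 0
    suppSize≤0 = subst (suppSize γ ≤_) s (suppSize≤sum γ)
    m≡0 : m ≡ 0
    m≡0 = trans (sym p) (n≤0⇒n≡0 suppSize≤0)
    trues≡0 : trues bs ≡ 0
    trues≡0 = n≤0⇒n≡0 (≤-trans (Covers⇒trues≤suppSize c) suppSize≤0)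

-- Split on the first exponent e. If e = 0 the first variable is unused (so it must not be
-- required); if e = 1 it is dropped from the support; if e ≥ 2 it is decremented and the first
-- variable becomes required. The counts add up by Pascal's rule for both factors.
mutual
  covering-bound : ∀ {n} (bs : Vec Bool n) ℓ m →
                   HasAtMost (binomDiff (falses bs) m (trues bs) * compositions ℓ m) (Covering bs ℓ m)
  covering-bound bs           zero    m       = covering-zero bs m
  covering-bound bs           (suc ℓ) zero    =
    HasAtMost-∅ λ {γ} (s , p , _) → case trans (sym (suppSize≡0⇒sum≡0 γ p)) s of λ ()
  covering-bound []           (suc ℓ) (suc m) = HasAtMost-∅ λ { {[]} (() , _) }
  covering-bound (false ∷ bs) (suc ℓ) (suc m) =
    HasAtMost-mono (≤-reflexive eq) (HasAtMost-partition (λ γ → head γ ≟ 0) head-zero (head-positive false bs ℓ m))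
    where
    head-zero : HasAtMost _ (Covering (false ∷ bs) (suc ℓ) (suc m) ∩ HeadZero)
    head-zero = HasAtMost-injection tail (λ (_ , γ≡0) (_ , δ≡0) → tail-injective-on-head (trans γ≡0 (sym δ≡0)))
                  (λ { {0 ∷ γ} ((s , p , _ ∷ c) , refl) → s , p , c }) (covering-bound bs (suc ℓ) (suc m))
    K = falses bs
    D = trues bs
    c = compositions (suc ℓ) (suc m)
    eq : binomDiff K (suc m) D * c + binomDiff K m D * c ≡ binomDiff (suc K) (suc m) D * c
    eq = begin
      binomDiff K (suc m) D * c + binomDiff K m D * c ≡⟨ *-distribʳ-+ c (binomDiff K (suc m) D) _ ⟨
      (binomDiff K (suc m) D + binomDiff K m D) * c   ≡⟨ cong (_* c) (binomDiff-pascal K m D) ⟨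
      binomDiff (suc K) (suc m) D * c                 ∎
      where open ≡-Reasoning
  covering-bound (true ∷ bs)  (suc ℓ) (suc m) =
    HasAtMost-partition (λ γ → head γ ≟ 0) (HasAtMost-∅ λ { {0 ∷ γ} ((_ , _ , c ∷ _) , _) → case c _ of λ () })
      (head-positive true bs ℓ m)

  head-positive : ∀ {n} b (bs : Vec Bool n) ℓ m →
                  HasAtMost (binomDiff (falses bs) m (trues bs) * compositions (suc ℓ) (suc m))
                            (Covering (b ∷ bs) (suc ℓ) (suc m) ∩ ∁ HeadZero)
  head-positive b bs ℓ m =
    HasAtMost-mono (≤-reflexive (sym (*-distribˡ-+ (binomDiff (falses bs) m (trues bs)) _ _)))
      (HasAtMost-partition (λ γ → head γ ≟ 1) head-one head-many)
    where
    head-one : HasAtMost _ ((Covering (b ∷ bs) (suc ℓ) (suc m) ∩ ∁ HeadZero) ∩ HeadOne)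
    head-one = HasAtMost-injection tail (λ (_ , γ≡1) (_ , δ≡1) → tail-injective-on-head (trans γ≡1 (sym δ≡1)))
                 (λ { {1 ∷ γ} (((s , p , _ ∷ c) , _) , refl) → suc-injective s , suc-injective p , c })
                 (covering-bound bs ℓ m)
    head-many : HasAtMost _ ((Covering (b ∷ bs) (suc ℓ) (suc m) ∩ ∁ HeadZero) ∩ ∁ HeadOne)
    head-many = HasAtMost-injection decrementHead
                  (λ ((_ , γ≢0) , _) ((_ , δ≢0) , _) → decrementHead-injective-on-¬HeadZero γ≢0 δ≢0)
                  (λ { {0 ∷ γ} ((_ , γ≢0) , _) → ⊥-elim (γ≢0 refl)
                     ; {1 ∷ γ} (_ , γ≢1) → ⊥-elim (γ≢1 refl)
                     ; {suc (suc e) ∷ γ} (((s , p , _ ∷ c) , _) , _) → suc-injective s , p , (λ _ → s≤s z≤n) ∷ c })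
                  (covering-bound (true ∷ bs) ℓ (suc m))

newVar : ℕ → ℕ → Bool
newVar zero (suc _) = true
newVar _    _       = false

newVars : ∀ {N} → Monomial N → Monomial N → Vec Bool N
newVars = zipWith newVar

_÷_ : ∀ {N} → Monomial N → Monomial N → Monomial N
μ ÷ α = zipWith _∸_ μ α

·-÷-cancel : ∀ {N} (α γ : Monomial N) → (α · γ) ÷ α ≡ γ
·-÷-cancel []      []      = refl
·-÷-cancel (a ∷ α) (e ∷ γ) = cong₂ _∷_ (m+n∸m≡n a e) (·-÷-cancel α γ)

Covers-newVars : ∀ {N} (α β γ γ′ : Monomial N) → α · γ ≡ β · γ′ → Covers (newVars α β) γ
Covers-newVars []      []      []      []        _ = []
Covers-newVars (a ∷ α) (b ∷ β) (e ∷ γ) (e′ ∷ γ′) eq =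
  positive a b (cong head eq) ∷ Covers-newVars α β γ γ′ (cong tail eq)
  where
  positive : ∀ a b → a + e ≡ b + e′ → T (newVar a b) → 0 < e
  positive zero (suc b) refl _ = s≤s z≤n

commonSize-comm : ∀ {N} (α β : Monomial N) → commonSize α β ≡ commonSize β α
commonSize-comm []      []      = refl
commonSize-comm (a ∷ α) (b ∷ β) = cong₂ _+_ (⊓-comm a b) (commonSize-comm α β)

deg≡commonSize+trues-newVars : ∀ {N} {α β : Monomial N} → Multilinear α → Multilinear β →
                               deg β ≡ commonSize α β + trues (newVars α β)
deg≡commonSize+trues-newVars {α = []}          {[]}          []        []        = refl
deg≡commonSize+trues-newVars {α = zero ∷ _}    {zero ∷ _}    (_ ∷ mα) (_ ∷ mβ) = deg≡commonSize+trues-newVars mα mβ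
deg≡commonSize+trues-newVars {α = zero ∷ _}    {suc zero ∷ _} (_ ∷ mα) (_ ∷ mβ) =
  trans (cong suc (deg≡commonSize+trues-newVars mα mβ)) (sym (+-suc _ _))
deg≡commonSize+trues-newVars {α = suc zero ∷ _} {zero ∷ _}    (_ ∷ mα) (_ ∷ mβ) = deg≡commonSize+trues-newVars mα mβ
deg≡commonSize+trues-newVars {α = suc zero ∷ _} {suc zero ∷ _} (_ ∷ mα) (_ ∷ mβ) = cong suc (deg≡commonSize+trues-newVars mα mβ)
deg≡commonSize+trues-newVars {α = suc (suc _) ∷ _} (s≤s () ∷ _) _
deg≡commonSize+trues-newVars {β = suc (suc _) ∷ _} _ (s≤s () ∷ _)

no-newVars⇒≡ : ∀ {N} {α β : Monomial N} → Multilinear α → Multilinear β →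
               trues (newVars α β) ≡ 0 → trues (newVars β α) ≡ 0 → α ≡ β
no-newVars⇒≡ {α = []}             {[]}           []        []        _ _ = refl
no-newVars⇒≡ {α = zero ∷ _}       {zero ∷ _}     (_ ∷ mα) (_ ∷ mβ) p q = cong (0 ∷_) (no-newVars⇒≡ mα mβ p q)
no-newVars⇒≡ {α = suc zero ∷ _}   {suc zero ∷ _} (_ ∷ mα) (_ ∷ mβ) p q = cong (1 ∷_) (no-newVars⇒≡ mα mβ p q)
no-newVars⇒≡ {α = zero ∷ _}       {suc zero ∷ _} _ _ () _
no-newVars⇒≡ {α = suc zero ∷ _}   {zero ∷ _}     _ _ _ ()
no-newVars⇒≡ {α = suc (suc _) ∷ _} (s≤s () ∷ _) _ _ _
no-newVars⇒≡ {β = suc (suc _) ∷ _} _ (s≤s () ∷ _) _ _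

dist≡trues-newVars : ∀ {N} {α β : Monomial N} → Multilinear α → Multilinear β → deg α ≡ deg β →
                     dist α β ≡ trues (newVars α β)
dist≡trues-newVars {α = α} {β} mα mβ degα≡degβ = begin
  (deg α ∸ c) ⊓ (deg β ∸ c)  ≡⟨ cong (λ d → (d ∸ c) ⊓ (deg β ∸ c)) degα≡degβ ⟩
  (deg β ∸ c) ⊓ (deg β ∸ c)  ≡⟨ ⊓-idem (deg β ∸ c) ⟩
  deg β ∸ c                  ≡⟨ cong (_∸ c) (deg≡commonSize+trues-newVars mα mβ) ⟩
  c + trues (newVars α β) ∸ c ≡⟨ m+n∸m≡n c _ ⟩
  trues (newVars α β)        ∎
  where
  open ≡-Reasoning
  c = commonSize α β

newVars-nonempty : ∀ {N} {α β : Monomial N} → Multilinear α → Multilinear β → deg α ≡ deg β → ¬ α ≡ β →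
                   0 < trues (newVars α β)
newVars-nonempty {α = α} {β} mα mβ degα≡degβ α≢β = n≢0⇒n>0 λ none →
  α≢β (no-newVars⇒≡ mα mβ none (trans trues-newVars-sym none))
  where
  trues-newVars-sym : trues (newVars β α) ≡ trues (newVars α β)
  trues-newVars-sym = +-cancelˡ-≡ (commonSize α β) _ _ (begin
    commonSize α β + trues (newVars β α) ≡⟨ cong (_+ trues (newVars β α)) (commonSize-comm α β) ⟩
    commonSize β α + trues (newVars β α) ≡⟨ deg≡commonSize+trues-newVars mβ mα ⟨
    deg α                                ≡⟨ degα≡degβ ⟩
    deg β                                ≡⟨ deg≡commonSize+trues-newVars mα mβ ⟩
    commonSize α β + trues (newVars α β) ∎)
    where open ≡-Reasoning

binomDiff*compositions≤ : ∀ K {D} ℓ m → 0 < D →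
                          binomDiff K m D * compositions ℓ m ≤ binomDiff K m D * binomDiff (ℓ ∸ 1) m 1
binomDiff*compositions≤ K {suc D} ℓ zero    _ = z≤n
binomDiff*compositions≤ K {suc D} ℓ (suc m) _ = *-monoʳ-≤ (binomDiff K (suc m) (suc D)) (compositions≤binomDiff ℓ m)

lemma4p5 : (N ℓ m : ℕ) (α β : Monomial N) →
    Multilinear α → Multilinear β → ¬ (α ≡ β) → deg α ≡ deg β →
    (xs : List (Monomial N)) → Unique xs →
    All (λ μ → InS ℓ m α μ × InS ℓ m β μ) xs →
    length xs ≤ binomDiff (N ∸ dist α β) m (dist α β) * binomDiff (ℓ ∸ 1) m 1
lemma4p5 N ℓ m α β mα mβ α≢β degα≡degβ xs u ps = begin
  length xs                                        ≤⟨ HasAtMost-injection (_÷ α) cofactor-injective cofactor-covering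
                                                        (covering-bound E ℓ m) xs u ps ⟩
  binomDiff (falses E) m Δ * compositions ℓ m      ≤⟨ binomDiff*compositions≤ (falses E) ℓ m
                                                        (newVars-nonempty mα mβ degα≡degβ α≢β) ⟩
  binomDiff (falses E) m Δ * binomDiff (ℓ ∸ 1) m 1 ≡⟨ cong₂ (λ K D → binomDiff K m D * binomDiff (ℓ ∸ 1) m 1) N∸dist≡falses dist≡Δ ⟨
  binomDiff (N ∸ dist α β) m (dist α β) * binomDiff (ℓ ∸ 1) m 1 ∎
  where
  open ≤-Reasoning
  E = newVars α β
  Δ = trues E
  dist≡Δ : dist α β ≡ Δ
  dist≡Δ = dist≡trues-newVars mα mβ degα≡degβ
  N∸dist≡falses : N ∸ dist α β ≡ falses E
  N∸dist≡falses = trans (cong₂ _∸_ (sym (falses+trues E)) dist≡Δ) (m+n∸n≡m (falses E) Δ)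
  cofactor-injective : ∀ {μ ν} → InS ℓ m α μ × InS ℓ m β μ → InS ℓ m α ν × InS ℓ m β ν → μ ÷ α ≡ ν ÷ α → μ ≡ ν
  cofactor-injective ((γ , _ , _ , refl) , _) ((δ , _ , _ , refl) , _) eq =
    cong (α ·_) (trans (sym (·-÷-cancel α γ)) (trans eq (·-÷-cancel α δ)))
  cofactor-covering : ∀ {μ} → InS ℓ m α μ × InS ℓ m β μ → Covering E ℓ m (μ ÷ α)
  cofactor-covering ((γ , degγ , suppγ , refl) , (γ′ , _ , _ , αγ≡βγ′)) rewrite ·-÷-cancel α γ =
    degγ , suppγ , Covers-newVars α β γ γ′ αγ≡βγ′
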